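{- The smallest number of vertices of a finite 5-regular simple graph $G$ which, for every $r \in \{1,2,3,4,5\}$, has an independent exact $r$-cover, is $6048$.
   Context: Let $G$ be a $d$-regular simple graph. For $0 \le r \le d$, an independent exact $r$-cover of $G$ is a subset $S \subseteq V(G)$ such that no edge of $G$ has both endpoints in $S$, and every vertex of $V(G)\setminus S$ is adjacent to exactly $r$ vertices of $S$. -}

module Defs where

open import Data.Nat using (ℕ; zero; suc; _+_; _≤_)
open import Data.Fin using (Fin; zero; suc)
open import Data.Bool using (Bool; true; false; _∧_; if_then_else_)
open import Data.Product using (Σ; _×_)
open import Relation.Binary.PropositionalEquality using (_≡_)

countFin : ∀ {n} → (Fin n → Bool) → ℕ
countFin {zero}  f = 0
countFin {suc n} f = (if f zero then 1 else 0) + countFin (λ i → f (suc i))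

record SimpleGraph (n : ℕ) : Set where
  field
    adj   : Fin n → Fin n → Bool
    sym   : ∀ u v → adj u v ≡ adj v u
    irrefl : ∀ v → adj v v ≡ false

open SimpleGraph public

degree : ∀ {n} → SimpleGraph n → Fin n → ℕ
degree G v = countFin (adj G v)

Regular : ∀ {n} → ℕ → SimpleGraph n → Set
Regular d G = ∀ v → degree G v ≡ d

Independent : ∀ {n} → SimpleGraph n → (Fin n → Bool) → Set
Independent G S = ∀ u v → adj G u v ≡ true → S u ≡ true → S v ≡ false

ExactCover : ∀ {n} → SimpleGraph n → ℕ → (Fin n → Bool) → Set
ExactCover G r S = ∀ v → S v ≡ false → countFin (λ u → adj G v u ∧ S u) ≡ r

IndependentExactCover : ∀ {n} → SimpleGraph n → ℕ → (Fin n → Bool) → Set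
IndependentExactCover G r S = Independent G S × ExactCover G r S

HasAllCovers : ∀ {n} → SimpleGraph n → Set
HasAllCovers G = ∀ r → 1 ≤ r → r ≤ 5 → Σ (Fin _ → Bool) (IndependentExactCover G r)

{-# OPTIONS --safe #-}
-- Let A be an independent exact 5-cover of a 5-regular graph. Every vertex outside A has all
-- five neighbours in A, so the graph is bipartite with sides A and ∁ A, both of size m, and
-- ∁ A is an exact 5-cover as well. For independent exact covers T and U of weights r and r′,
-- double counting the edges between (B ∩ T) ∖ U and (∁ B ∩ U) ∖ T, B a side, gives
-- r′ |(B ∩ T) ∖ U| = r |(∁ B ∩ U) ∖ T|. Taking U to be a side shows that T meets both sides
-- equally and that r m = (r + 5) |A ∩ T|, so 7 ∣ 2m (r = 2); comparing the 1-cover with the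
-- 3-cover and the 4-cover side by side gives m = 16x and 2m = 27y. Hence 6048 = 32 · 27 · 7
-- divides the order 2m.
--
-- Conversely, for 1 ≤ r ≤ 4 let colour i ∈ Fin 5 match j ∈ Fin r with j + i mod 5 ∈ Fin 5 and
-- fix the other vertices of Fin 5; then Fin r is an independent exact r-cover. The bipartite
-- double cover of the colourwise product of these four gadgets has 2 · 6 · 7 · 8 · 9 = 6048
-- vertices, is simple because the 4-gadget is, and all five covers pull back to it.
module Submission where

open import Algebra.Bundles using (CommutativeMonoid)
open import Data.Bool using (Bool; true; false; _∧_; _∨_; not; if_then_else_)
open import Data.Bool.Properties
  using (∧-zeroʳ; ∧-identityʳ; ∧-idem; not-involutive; not-injective; ∧-commutativeMonoid)
open import Data.Empty using (⊥-elim)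
open import Data.Fin using (Fin; zero; suc; toℕ)
open import Data.Fin.Properties
  using (any?; all?; suc-injective; 0≢1+n; 2↔Bool; +↔⊎; *↔×) renaming (_≟_ to _≟ᶠ_)
open import Data.List using (_∷_; [])
open import Data.Maybe using (is-just)
open import Data.Nat using (ℕ; zero; suc; _+_; _*_; _≤_; _≤?_; _≟_; s≤s; NonZero; >-nonZero)
open import Data.Nat.DivMod using (_mod_)
open import Data.Nat.Divisibility using (_∣_; divides; ∣⇒≤)
open import Data.Nat.LCM using (lcm-least)
open import Data.Nat.Properties
  using (+-*-semiring; +-identityʳ; *-identityʳ; +-cancelˡ-≡; *-cancelˡ-≡; *-cancelʳ-≡;
         *-distribʳ-+; *-distribˡ-+; 1+n≢0)
open import Data.Nat.Tactic.RingSolver using (solve; solve-∀)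
open import Data.Product as Product using (Σ; ∃; _×_; _,_; proj₁; proj₂)
open import Data.Product.Function.NonDependent.Propositional using (_×-↔_)
open import Data.Sum using (_⊎_; inj₁; inj₂; [_,_]; isInj₁)
open import Data.Sum.Properties using (≡-dec)
open import Function using (_∘_; id; _↔_; Inverse; mk⇔)
open import Function.Construct.Composition using (_↔-∘_)
open import Function.Definitions using (Injective)
open import Relation.Binary.Definitions using (DecidableEquality)
open import Relation.Binary.PropositionalEquality
  using (_≡_; _≢_; refl; sym; trans; cong; cong₂; subst; module ≡-Reasoning)
open import Relation.Nullary.Decidable
  using (Dec; yes; no; True; toWitness; does; dec-false; does-⇔; map′; _×-dec_; _→-dec_)

open import Algebra.Properties.CommutativeSemigroup (CommutativeMonoid.commutativeSemigroup ∧-commutativeMonoid)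
  using (x∙yz≈z∙yx; x∙yz≈yx∙z; xy∙z≈xz∙y)
open import Algebra.Properties.Semiring.Sum +-*-semiring
  using (sum-syntax; sum-cong-≗; ∑-comm; ∑-distrib-+; *-distribʳ-sum)

open import Defs renaming (sym to adj-sym)

open ≡-Reasoning

-- Counting and double counting

𝟙 : Bool → ℕ
𝟙 b = if b then 1 else 0

module _ {n : ℕ} where

  infixr 7 _∩_
  infixl 6 _∖_

  _∩_ _∖_ : (Fin n → Bool) → (Fin n → Bool) → Fin n → Bool
  (P ∩ Q) v = P v ∧ Q v
  (P ∖ Q) v = P v ∧ not (Q v)

  ∁ : (Fin n → Bool) → Fin n → Bool
  ∁ P v = not (P v)

countFin-cong : ∀ {n} {f g : Fin n → Bool} → (∀ i → f i ≡ g i) → countFin f ≡ countFin g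
countFin-cong {zero}  f≗g = refl
countFin-cong {suc n} f≗g = cong₂ _+_ (cong 𝟙 (f≗g zero)) (countFin-cong (λ i → f≗g (suc i)))

countFin≡∑ : ∀ {n} (f : Fin n → Bool) → countFin f ≡ ∑[ i < n ] 𝟙 (f i)
countFin≡∑ {zero}  f = refl
countFin≡∑ {suc n} f = cong (𝟙 (f zero) +_) (countFin≡∑ (λ i → f (suc i)))

countFin-false : ∀ {n} {f : Fin n → Bool} → (∀ i → f i ≡ false) → countFin f ≡ 0
countFin-false {zero}  f≗false = refl
countFin-false {suc n} f≗false rewrite f≗false zero = countFin-false (λ i → f≗false (suc i))

countFin-true : ∀ n → countFin {n} (λ _ → true) ≡ n
countFin-true zero    = refl
countFin-true (suc n) = cong suc (countFin-true n)

countFin≡0⇒false : ∀ {n} (f : Fin n → Bool) → countFin f ≡ 0 → ∀ i → f i ≡ false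
countFin≡0⇒false f #f≡0 zero with f zero
... | false = refl
... | true  = ⊥-elim (1+n≢0 #f≡0)
countFin≡0⇒false f #f≡0 (suc i) with f zero
... | false = countFin≡0⇒false (λ j → f (suc j)) #f≡0 i
... | true  = ⊥-elim (1+n≢0 #f≡0)

countFin-split : ∀ {n} (f g : Fin n → Bool) → countFin f ≡ countFin (f ∩ g) + countFin (f ∖ g)
countFin-split {n} f g = begin
  countFin f                                          ≡⟨ countFin≡∑ f ⟩
  ∑[ i < n ] 𝟙 (f i)                                  ≡⟨ sum-cong-≗ (λ i → 𝟙-split (f i) (g i)) ⟩
  ∑[ i < n ] (𝟙 ((f ∩ g) i) + 𝟙 ((f ∖ g) i))          ≡⟨ ∑-distrib-+ (λ i → 𝟙 ((f ∩ g) i)) _ ⟩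
  ∑[ i < n ] 𝟙 ((f ∩ g) i) + ∑[ i < n ] 𝟙 ((f ∖ g) i) ≡⟨ sym (cong₂ _+_ (countFin≡∑ (f ∩ g)) (countFin≡∑ (f ∖ g))) ⟩
  countFin (f ∩ g) + countFin (f ∖ g)                 ∎
  where
  𝟙-split : ∀ a b → 𝟙 a ≡ 𝟙 (a ∧ b) + 𝟙 (a ∧ not b)
  𝟙-split true  true  = refl
  𝟙-split true  false = refl
  𝟙-split false _     = refl

module DoubleCounting {n} (G : SimpleGraph n) where

  neighboursIn : (Fin n → Bool) → Fin n → ℕ
  neighboursIn S v = countFin (λ u → adj G v u ∧ S u)

  edges : (Fin n → Bool) → (Fin n → Bool) → ℕ
  edges P Q = ∑[ v < n ] countFin (λ u → P v ∧ (adj G v u ∧ Q u))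

  edges-cong : ∀ {P Q P′ Q′} → (∀ v u → P v ∧ (adj G v u ∧ Q u) ≡ P′ v ∧ (adj G v u ∧ Q′ u)) →
               edges P Q ≡ edges P′ Q′
  edges-cong eq = sum-cong-≗ (λ v → countFin-cong (eq v))

  edges-comm : ∀ P Q → edges P Q ≡ edges Q P
  edges-comm P Q = begin
    edges P Q                                               ≡⟨ sum-cong-≗ (λ v → countFin≡∑ (λ u → P v ∧ (adj G v u ∧ Q u))) ⟩
    ∑[ v < n ] ∑[ u < n ] 𝟙 (P v ∧ (adj G v u ∧ Q u))       ≡⟨ ∑-comm (λ v u → 𝟙 (P v ∧ (adj G v u ∧ Q u))) ⟩
    ∑[ u < n ] ∑[ v < n ] 𝟙 (P v ∧ (adj G v u ∧ Q u))       ≡⟨ sum-cong-≗ (λ u → sum-cong-≗ (λ v → cong 𝟙 (flip-edge v u))) ⟩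
    ∑[ u < n ] ∑[ v < n ] 𝟙 (Q u ∧ (adj G u v ∧ P v))       ≡⟨ sum-cong-≗ (λ u → countFin≡∑ (λ v → Q u ∧ (adj G u v ∧ P v))) ⟨
    edges Q P                                               ∎
    where
    flip-edge : ∀ v u → P v ∧ (adj G v u ∧ Q u) ≡ Q u ∧ (adj G u v ∧ P v)
    flip-edge v u = trans (x∙yz≈z∙yx (P v) _ (Q u)) (cong (λ b → Q u ∧ (b ∧ P v)) (adj-sym G v u))

  no-neighbours-inside : ∀ {S v} → Independent G S → S v ≡ true → neighboursIn S v ≡ 0
  no-neighbours-inside {S} {v} independent Sv = countFin-false neighbour-outside
    where
    neighbour-outside : ∀ u → adj G v u ∧ S u ≡ false
    neighbour-outside u with adj G v u in vu
    ... | true  = independent v u vu Sv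
    ... | false = refl

  edges-cover : ∀ {r S} → IndependentExactCover G r S → ∀ P → edges P S ≡ countFin (P ∖ S) * r
  edges-cover {r} {S} (independent , exact) P = begin
    edges P S                               ≡⟨ sum-cong-≗ (λ v → row (P v) v) ⟩
    ∑[ v < n ] (𝟙 ((P ∖ S) v) * r)          ≡⟨ *-distribʳ-sum r (λ v → 𝟙 ((P ∖ S) v)) ⟨
    (∑[ v < n ] 𝟙 ((P ∖ S) v)) * r          ≡⟨ cong (_* r) (countFin≡∑ (P ∖ S)) ⟨
    countFin (P ∖ S) * r                    ∎
    where
    row : ∀ p v → countFin (λ u → p ∧ (adj G v u ∧ S u)) ≡ 𝟙 (p ∧ not (S v)) * r
    row false v = countFin-false {n} (λ _ → refl)
    row true  v with S v in Sv
    ... | true  = no-neighbours-inside independent Sv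
    ... | false = trans (exact v Sv) (sym (+-identityʳ r))

  Bipartition : (Fin n → Bool) → Set
  Bipartition B = ∀ u w → adj G u w ≡ true → B w ≡ not (B u)

  edges-across : ∀ {B} → Bipartition B → ∀ U T → edges U (B ∩ T) ≡ edges (∁ B ∩ U) T
  edges-across {B} bipartite U T = edges-cong {U} {B ∩ T} {∁ B ∩ U} {T} across
    where
    across : ∀ u w → U u ∧ (adj G u w ∧ (B ∩ T) w) ≡ (∁ B ∩ U) u ∧ (adj G u w ∧ T w)
    across u w with adj G u w in uw
    ... | false = trans (∧-zeroʳ (U u)) (sym (∧-zeroʳ _))
    ... | true rewrite bipartite u w uw = x∙yz≈yx∙z (U u) (not (B u)) (T w)

  cover-balance : ∀ {B r r′ T U} → Bipartition B →
                  IndependentExactCover G r T → IndependentExactCover G r′ U →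
                  countFin ((B ∩ T) ∖ U) * r′ ≡ countFin ((∁ B ∩ U) ∖ T) * r
  cover-balance {B} {T = T} {U} bipartite T-cover U-cover = begin
    countFin ((B ∩ T) ∖ U) * _   ≡⟨ edges-cover U-cover (B ∩ T) ⟨
    edges (B ∩ T) U              ≡⟨ edges-comm (B ∩ T) U ⟩
    edges U (B ∩ T)              ≡⟨ edges-across bipartite U T ⟩
    edges (∁ B ∩ U) T            ≡⟨ edges-cover T-cover (∁ B ∩ U) ⟩
    countFin ((∁ B ∩ U) ∖ T) * _ ∎

  ∁-bipartition : ∀ {B} → Bipartition B → Bipartition (∁ B)
  ∁-bipartition bipartite u w uw = cong not (bipartite u w uw)

  cover-balance-∁ : ∀ {B r r′ T U} → Bipartition B →
                    IndependentExactCover G r T → IndependentExactCover G r′ U →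
                    countFin ((∁ B ∩ T) ∖ U) * r′ ≡ countFin ((B ∩ U) ∖ T) * r
  cover-balance-∁ {B} {r} {T = T} {U} bipartite T-cover U-cover =
    trans (cover-balance (∁-bipartition bipartite) T-cover U-cover)
          (cong (_* r) (countFin-cong (λ v → cong (λ b → (b ∧ U v) ∧ not (T v)) (not-involutive (B v)))))

-- Arithmetic

*-+-cross-cancel : ∀ {p q} a b → p ≢ q → a * p + b * q ≡ b * p + a * q → a ≡ b
*-+-cross-cancel zero    zero    p≢q eq = refl
*-+-cross-cancel zero    (suc b) p≢q eq = ⊥-elim (p≢q (*-cancelˡ-≡ _ _ (suc b) (sym (trans eq (+-identityʳ _)))))
*-+-cross-cancel (suc a) zero    p≢q eq = ⊥-elim (p≢q (*-cancelˡ-≡ _ _ (suc a) (trans (sym (+-identityʳ _)) eq)))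
*-+-cross-cancel {p} {q} (suc a) (suc b) p≢q eq =
  cong suc (*-+-cross-cancel a b p≢q (+-cancelˡ-≡ (p + q) _ _ (begin
    (p + q) + (a * p + b * q)  ≡⟨ solve (p ∷ q ∷ a ∷ b ∷ []) ⟩
    suc a * p + suc b * q      ≡⟨ eq ⟩
    suc b * p + suc a * q      ≡⟨ solve (p ∷ q ∷ a ∷ b ∷ []) ⟩
    (p + q) + (b * p + a * q)  ∎)))

cover-profile-arith : ∀ {d r m a a′ b b′} → r ≢ d → m ≡ a + a′ → m ≡ b + b′ →
                      a * d ≡ b′ * r → b * d ≡ a′ * r → a ≡ b × m * r ≡ a * (r + d)
cover-profile-arith {d} {r} {m} {a} {a′} {b} {b′} r≢d m≡a+a′ m≡b+b′ ad≡b′r bd≡a′r = a≡b , mr≡a[r+d]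
  where
  mr≡ar+bd : m * r ≡ a * r + b * d
  mr≡ar+bd = begin
    m * r            ≡⟨ cong (_* r) m≡a+a′ ⟩
    (a + a′) * r     ≡⟨ *-distribʳ-+ r a a′ ⟩
    a * r + a′ * r   ≡⟨ cong (a * r +_) bd≡a′r ⟨
    a * r + b * d    ∎
  mr≡br+ad : m * r ≡ b * r + a * d
  mr≡br+ad = begin
    m * r            ≡⟨ cong (_* r) m≡b+b′ ⟩
    (b + b′) * r     ≡⟨ *-distribʳ-+ r b b′ ⟩
    b * r + b′ * r   ≡⟨ cong (b * r +_) ad≡b′r ⟨
    b * r + a * d    ∎
  a≡b : a ≡ b
  a≡b = *-+-cross-cancel a b r≢d (trans (sym mr≡ar+bd) mr≡br+ad)
  mr≡a[r+d] : m * r ≡ a * (r + d)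
  mr≡a[r+d] = begin
    m * r          ≡⟨ mr≡ar+bd ⟩
    a * r + b * d  ≡⟨ cong (λ x → a * r + x * d) a≡b ⟨
    a * r + a * d  ≡⟨ *-distribˡ-+ a r d ⟨
    a * (r + d)    ∎

-- t, u are the sizes of T, U on either side; x, p, q are those of T ∩ U, T ∖ U, U ∖ T on one side
-- and x′, p′, q′ those on the other.
cover-pair-arith : ∀ {r r′ t u x p q x′ p′ q′} .{{_ : NonZero (r + r′)}} →
                   t ≡ x + p → t ≡ x′ + p′ → u ≡ x + q → u ≡ x′ + q′ →
                   p * r′ ≡ q′ * r → p′ * r′ ≡ q * r → p * r′ ≡ q * r
cover-pair-arith {r} {r′} {t} {u} {x} {p} {q} {x′} {p′} {q′} t≡x+p t≡x′+p′ u≡x+q u≡x′+q′ pr′≡q′r p′r′≡qr =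
  trans pr′≡q′r (cong (_* r) q′≡q)
  where
  balance : ∀ y s y′ s′ → t ≡ y + s → u ≡ y′ + s′ → s * r′ ≡ s′ * r → t * r′ + y′ * r ≡ y * r′ + u * r
  balance y s y′ s′ t≡y+s u≡y′+s′ sr′≡s′r = begin
    t * r′ + y′ * r               ≡⟨ cong (λ z → z * r′ + y′ * r) t≡y+s ⟩
    (y + s) * r′ + y′ * r         ≡⟨ solve (y ∷ s ∷ y′ ∷ r ∷ r′ ∷ []) ⟩
    y * r′ + s * r′ + y′ * r      ≡⟨ cong (λ z → y * r′ + z + y′ * r) sr′≡s′r ⟩
    y * r′ + s′ * r + y′ * r      ≡⟨ solve (y ∷ s′ ∷ y′ ∷ r ∷ r′ ∷ []) ⟩
    y * r′ + (y′ + s′) * r        ≡⟨ cong (λ z → y * r′ + z * r) u≡y′+s′ ⟨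
    y * r′ + u * r                ∎
  x≡x′ : x ≡ x′
  x≡x′ = sym (*-cancelʳ-≡ x′ x (r + r′) (+-cancelˡ-≡ (t * r′ + u * r) _ _ (begin
    (t * r′ + u * r) + x′ * (r + r′)      ≡⟨ solve (t ∷ u ∷ x′ ∷ r ∷ r′ ∷ []) ⟩
    (t * r′ + x′ * r) + (x′ * r′ + u * r) ≡⟨ cong₂ _+_ (balance x p x′ q′ t≡x+p u≡x′+q′ pr′≡q′r)
                                                       (sym (balance x′ p′ x q t≡x′+p′ u≡x+q p′r′≡qr)) ⟩
    (x * r′ + u * r) + (t * r′ + x * r)   ≡⟨ solve (t ∷ u ∷ x ∷ r ∷ r′ ∷ []) ⟩
    (t * r′ + u * r) + x * (r + r′)       ∎)))
  q′≡q : q′ ≡ q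
  q′≡q = +-cancelˡ-≡ x _ _ (trans (cong (_+ q′) x≡x′) (trans (sym u≡x′+q′) u≡x+q))

one-cover-pair-arith : ∀ {k m t u x p q} → k ≢ 1 → m * 1 ≡ t * 6 → m * k ≡ u * (k + 5) →
                       t ≡ x + p → u ≡ x + q → p * k ≡ q * 1 → k * m ≡ 6 * (k + 5) * x
one-cover-pair-arith {k} {m} {_} {u} {x} {p} {q} k≢1 m≡6t mk≡u[k+5] t≡x+p u≡x+q pk≡q = begin
  k * m                         ≡⟨ cong (k *_) m≡6[x+p] ⟩
  k * ((x + p) * 6)             ≡⟨ solve (k ∷ x ∷ p ∷ []) ⟩
  6 * (k * x) + 6 * (p * k)     ≡⟨ cong (λ z → 6 * (k * x) + 6 * z) 5x≡pk ⟨
  6 * (k * x) + 6 * (x * 5)     ≡⟨ solve (k ∷ x ∷ []) ⟩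
  6 * (k + 5) * x               ∎
  where
  m≡6[x+p] : m ≡ (x + p) * 6
  m≡6[x+p] = trans (sym (*-identityʳ m)) (trans m≡6t (cong (_* 6) t≡x+p))
  q≡pk : q ≡ p * k
  q≡pk = sym (trans pk≡q (*-identityʳ q))
  -- k · 6 (x + p) = (x + k p) (k + 5) says 5x (k − 1) = k p (k − 1).
  5x≡pk : x * 5 ≡ p * k
  5x≡pk = *-+-cross-cancel (x * 5) (p * k) k≢1 (+-cancelˡ-≡ (x * k + p * k * 5) _ _ (begin
    (x * k + p * k * 5) + (x * 5 * k + p * k * 1)  ≡⟨ solve (k ∷ x ∷ p ∷ []) ⟩
    (x + p) * 6 * k                                ≡⟨ cong (_* k) m≡6[x+p] ⟨
    m * k                                          ≡⟨ mk≡u[k+5] ⟩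
    u * (k + 5)                                    ≡⟨ cong (λ z → z * (k + 5)) (trans u≡x+q (cong (x +_) q≡pk)) ⟩
    (x + p * k) * (k + 5)                          ≡⟨ solve (k ∷ x ∷ p ∷ []) ⟩
    (x * k + p * k * 5) + (p * k * k + x * 5 * 1)  ∎))

3*m≡48*x⇒32∣m+m : ∀ {m x} → 3 * m ≡ 48 * x → 32 ∣ m + m
3*m≡48*x⇒32∣m+m {m} {x} 3m≡48x = divides x (begin
  m + m              ≡⟨ cong₂ _+_ m≡16x m≡16x ⟩
  16 * x + 16 * x    ≡⟨ solve (x ∷ []) ⟩
  x * 32             ∎)
  where
  m≡16x : m ≡ 16 * x
  m≡16x = *-cancelˡ-≡ m (16 * x) 3 (trans 3m≡48x (solve (x ∷ [])))

4*m≡54*x⇒27∣m+m : ∀ {m x} → 4 * m ≡ 54 * x → 27 ∣ m + m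
4*m≡54*x⇒27∣m+m {m} {x} 4m≡54x = divides x (*-cancelˡ-≡ (m + m) (x * 27) 2 (begin
  2 * (m + m)   ≡⟨ solve (m ∷ []) ⟩
  4 * m         ≡⟨ 4m≡54x ⟩
  54 * x        ≡⟨ solve (x ∷ []) ⟩
  2 * (x * 27)  ∎))

m*2≡a*7⇒7∣m+m : ∀ {m a} → m * 2 ≡ a * 7 → 7 ∣ m + m
m*2≡a*7⇒7∣m+m {m} {a} m2≡7a = divides a (trans (solve (m ∷ [])) m2≡7a)

-- The lower bound

module FullCover {n d} (G : SimpleGraph n) (regular : Regular d G) .{{_ : NonZero d}}
                 (A : Fin n → Bool) (A-cover : IndependentExactCover G d A) where

  open DoubleCounting G

  degree-split : ∀ S v → d ≡ neighboursIn S v + neighboursIn (∁ S) v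
  degree-split S v = trans (sym (regular v)) (countFin-split (adj G v) S)

  A-bipartition : Bipartition A
  A-bipartition u w uw with A u in Au
  ... | true  = proj₁ A-cover u w uw Au
  ... | false = not-injective (trans (cong (_∧ not (A w)) (sym uw)) (countFin≡0⇒false _ no-∁A-neighbour w))
    where
    no-∁A-neighbour : neighboursIn (∁ A) u ≡ 0
    no-∁A-neighbour = +-cancelˡ-≡ d _ _ (trans (cong (_+ _) (sym (proj₂ A-cover u Au)))
                                               (trans (sym (degree-split A u)) (sym (+-identityʳ d))))

  ∁A-cover : IndependentExactCover G d (∁ A)
  ∁A-cover = independent , exact
    where
    independent : Independent G (∁ A)
    independent u w uw ∁Au = cong not (trans (A-bipartition u w uw) ∁Au)
    exact : ExactCover G d (∁ A)
    exact v ∁Av = sym (trans (degree-split A v) (cong (_+ neighboursIn (∁ A) v) no-A-neighbour))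
      where
      no-A-neighbour : neighboursIn A v ≡ 0
      no-A-neighbour = no-neighbours-inside (proj₁ A-cover) (not-injective ∁Av)

  side-counts : ∀ {r T} → IndependentExactCover G r T →
                countFin (A ∩ T) * d ≡ countFin (∁ A ∖ T) * r × countFin (∁ A ∩ T) * d ≡ countFin (A ∖ T) * r
  side-counts {r} {T} T-cover =
      trans (cong (_* d) (countFin-cong (λ v → sym (drop-∁∁ (A v) (T v)))))
            (trans (cover-balance A-bipartition T-cover ∁A-cover)
                   (cong (_* r) (countFin-cong (λ v → cong (_∧ not (T v)) (∧-idem (not (A v)))))))
    , trans (cong (_* d) (countFin-cong (λ v → sym (∧-absorbs-dup (not (A v)) (T v)))))
            (trans (cover-balance-∁ A-bipartition T-cover A-cover)
                   (cong (_* r) (countFin-cong (λ v → cong (_∧ not (T v)) (∧-idem (A v))))))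
    where
    ∧-absorbs-dup : ∀ a t → (a ∧ t) ∧ a ≡ a ∧ t
    ∧-absorbs-dup true  t = ∧-identityʳ t
    ∧-absorbs-dup false t = refl
    drop-∁∁ : ∀ a t → (a ∧ t) ∧ not (not a) ≡ a ∧ t
    drop-∁∁ a t = trans (cong ((a ∧ t) ∧_) (not-involutive a)) (∧-absorbs-dup a t)

  A-balanced : countFin A ≡ countFin (∁ A)
  A-balanced = *-cancelʳ-≡ _ _ d (begin
    countFin A * d           ≡⟨ cong (_* d) (countFin-cong (λ v → ∧-idem (A v))) ⟨
    countFin (A ∩ A) * d     ≡⟨ proj₁ (side-counts A-cover) ⟩
    countFin (∁ A ∖ A) * d   ≡⟨ cong (_* d) (countFin-cong (λ v → ∧-idem (not (A v)))) ⟩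
    countFin (∁ A) * d       ∎)

  order≡2m : n ≡ countFin A + countFin A
  order≡2m = begin
    n                              ≡⟨ countFin-true n ⟨
    countFin {n} (λ _ → true)      ≡⟨ countFin-split (λ _ → true) A ⟩
    countFin A + countFin (∁ A)    ≡⟨ cong (countFin A +_) A-balanced ⟨
    countFin A + countFin A        ∎

  cover-profile : ∀ {r T} → r ≢ d → IndependentExactCover G r T →
                  countFin (A ∩ T) ≡ countFin (∁ A ∩ T) × countFin A * r ≡ countFin (A ∩ T) * (r + d)
  cover-profile {T = T} r≢d T-cover =
    cover-profile-arith r≢d (countFin-split A T) (trans A-balanced (countFin-split (∁ A) T))
                        (proj₁ (side-counts T-cover)) (proj₂ (side-counts T-cover))

  cover-pair : ∀ {r r′ T U} .{{_ : NonZero (r + r′)}} → r ≢ d → r′ ≢ d →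
               IndependentExactCover G r T → IndependentExactCover G r′ U →
               Σ ℕ λ x → Σ ℕ λ p → Σ ℕ λ q →
                 countFin (A ∩ T) ≡ x + p × countFin (A ∩ U) ≡ x + q × p * r′ ≡ q * r
  cover-pair {r} {r′} {T} {U} r≢d r′≢d T-cover U-cover =
    x , p , q , t≡x+p , u≡x+q ,
    cover-pair-arith {r} {r′} {x = x} {p} {q} {x′} {p′} {q′} t≡x+p t≡x′+p′ u≡x+q u≡x′+q′
                     (cover-balance A-bipartition T-cover U-cover) (cover-balance-∁ A-bipartition T-cover U-cover)
    where
    x p q x′ p′ q′ : ℕ
    x  = countFin ((A ∩ T) ∩ U)
    p  = countFin ((A ∩ T) ∖ U)
    q  = countFin ((A ∩ U) ∖ T)
    x′ = countFin ((∁ A ∩ T) ∩ U)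
    p′ = countFin ((∁ A ∩ T) ∖ U)
    q′ = countFin ((∁ A ∩ U) ∖ T)
    split-U : ∀ S → countFin (S ∩ U) ≡ countFin ((S ∩ T) ∩ U) + countFin ((S ∩ U) ∖ T)
    split-U S = trans (countFin-split (S ∩ U) T)
                      (cong (_+ countFin ((S ∩ U) ∖ T)) (countFin-cong (λ v → xy∙z≈xz∙y (S v) (U v) (T v))))
    t≡x+p : countFin (A ∩ T) ≡ x + p
    t≡x+p = countFin-split (A ∩ T) U
    t≡x′+p′ : countFin (A ∩ T) ≡ x′ + p′
    t≡x′+p′ = trans (proj₁ (cover-profile r≢d T-cover)) (countFin-split (∁ A ∩ T) U)
    u≡x+q : countFin (A ∩ U) ≡ x + q
    u≡x+q = split-U A
    u≡x′+q′ : countFin (A ∩ U) ≡ x′ + q′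
    u≡x′+q′ = trans (proj₁ (cover-profile r′≢d U-cover)) (split-U (∁ A))

lower-bound : ∀ n → 1 ≤ n → (G : SimpleGraph n) → Regular 5 G → HasAllCovers G → 6048 ≤ n
lower-bound n 1≤n G regular covers =
  ∣⇒≤ ⦃ >-nonZero 1≤n ⦄ (subst (6048 ∣_) (sym order≡2m) (lcm-least (lcm-least 32∣2m 27∣2m) 7∣2m))
  where
  cover : ∀ r → {True (1 ≤? r)} → {True (r ≤? 5)} → Σ (Fin n → Bool) (IndependentExactCover G r)
  cover r {1≤r} {r≤5} = covers r (toWitness 1≤r) (toWitness r≤5)

  A : Fin n → Bool
  A = proj₁ (cover 5)

  open FullCover G regular A (proj₂ (cover 5))

  m : ℕ
  m = countFin A

  profile : ∀ {r T} → r ≢ 5 → IndependentExactCover G r T → Σ ℕ λ a → m * r ≡ a * (r + 5)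
  profile {T = T} r≢5 T-cover = countFin (A ∩ T) , proj₂ (cover-profile r≢5 T-cover)

  with-1-cover : ∀ {k U} → k ≢ 1 → k ≢ 5 → IndependentExactCover G k U → Σ ℕ λ x → k * m ≡ 6 * (k + 5) * x
  with-1-cover k≢1 k≢5 U-cover with cover-pair (λ ()) k≢5 (proj₂ (cover 1)) U-cover
  ... | x , p , q , t≡x+p , u≡x+q , pk≡q =
    x , one-cover-pair-arith k≢1 (proj₂ (profile (λ ()) (proj₂ (cover 1)))) (proj₂ (profile k≢5 U-cover))
                             t≡x+p u≡x+q pk≡q

  32∣2m : 32 ∣ m + m
  32∣2m = let x , 3m≡48x = with-1-cover (λ ()) (λ ()) (proj₂ (cover 3)) in 3*m≡48*x⇒32∣m+m {m} {x} 3m≡48x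

  27∣2m : 27 ∣ m + m
  27∣2m = let x , 4m≡54x = with-1-cover (λ ()) (λ ()) (proj₂ (cover 4)) in 4*m≡54*x⇒27∣m+m {m} {x} 4m≡54x

  7∣2m : 7 ∣ m + m
  7∣2m = let a , 2m≡7a = profile (λ ()) (proj₂ (cover 2)) in m*2≡a*7⇒7∣m+m {m} {a} 2m≡7a

-- Graphs from perfect matchings

countFin-insert : ∀ {n} (a : Fin n) (g h : Fin n → Bool) → g a ≡ false →
                  countFin (λ u → (does (u ≟ᶠ a) ∨ g u) ∧ h u) ≡ 𝟙 (h a) + countFin (g ∩ h)
countFin-insert zero    g h ga rewrite ga = refl
countFin-insert (suc a) g h ga =
  trans (cong (𝟙 (g zero ∧ h zero) +_) (countFin-insert a (λ u → g (suc u)) (λ u → h (suc u)) ga))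
        (+-left-comm (𝟙 (g zero ∧ h zero)) (𝟙 (h (suc a))) _)
  where
  +-left-comm : ∀ x y z → x + (y + z) ≡ y + (x + z)
  +-left-comm = solve-∀

countFin-image : ∀ {k n} (p : Fin k → Fin n) → Injective _≡_ _≡_ p → (h : Fin n → Bool) →
                 countFin (λ u → does (any? (λ i → u ≟ᶠ p i)) ∧ h u) ≡ countFin (λ i → h (p i))
countFin-image {zero} {n} p p-injective h = countFin-false {n} (λ _ → refl)
countFin-image {suc k} p p-injective h =
  trans (countFin-insert (p zero) _ h (dec-false (any? (λ i → p zero ≟ᶠ p (suc i))) (λ (i , e) → 0≢1+n (p-injective e))))
        (cong (𝟙 (h (p zero)) +_) (countFin-image (λ i → p (suc i)) (λ e → suc-injective (p-injective e)) h))

-- k colour classes, each a perfect matching given as an involution; a fixed point is a loop.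
record Matchings (k : ℕ) (V : Set) : Set where
  field
    nbr            : Fin k → V → V
    nbr-involutive : ∀ i v → nbr i (nbr i v) ≡ v

open Matchings

module _ {k : ℕ} where

  record IsHomomorphism {V W} (M : Matchings k V) (N : Matchings k W) (h : V → W) : Set where
    constructor homomorphism
    field
      commute : ∀ i v → h (nbr M i v) ≡ nbr N i (h v)

  Loopless : ∀ {V} → Matchings k V → Set
  Loopless M = ∀ i v → nbr M i v ≢ v

  NoMultiEdges : ∀ {V} → Matchings k V → Set
  NoMultiEdges M = ∀ v → Injective _≡_ _≡_ (λ i → nbr M i v)

  record MatchingCover {V} (M : Matchings k V) (r : ℕ) (S : V → Bool) : Set where
    field
      independent : ∀ i v → S v ≡ true → S (nbr M i v) ≡ false
      exact       : ∀ v → S v ≡ false → countFin (λ i → S (nbr M i v)) ≡ r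

  module _ {V W} {M : Matchings k V} {N : Matchings k W} {h : V → W} (hom : IsHomomorphism M N h) where

    open IsHomomorphism hom

    Loopless-pullback : Loopless N → Loopless M
    Loopless-pullback loopless i v e = loopless i (h v) (trans (sym (commute i v)) (cong h e))

    NoMultiEdges-pullback : NoMultiEdges N → NoMultiEdges M
    NoMultiEdges-pullback distinct v e = distinct (h v) (trans (sym (commute _ v)) (trans (cong h e) (commute _ v)))

    MatchingCover-pullback : ∀ {r S} → MatchingCover N r S → MatchingCover M r (S ∘ h)
    MatchingCover-pullback {S = S} cover = record
      { independent = λ i v Shv → trans (cong S (commute i v)) (MatchingCover.independent cover i (h v) Shv)
      ; exact       = λ v Shv → trans (countFin-cong (λ i → cong S (commute i v))) (MatchingCover.exact cover (h v) Shv)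
      }

  infixr 5 _⊗_

  _⊗_ : ∀ {V W} → Matchings k V → Matchings k W → Matchings k (V × W)
  nbr            (M ⊗ N) i           = Product.map (nbr M i) (nbr N i)
  nbr-involutive (M ⊗ N) i (v , w)   = cong₂ _,_ (nbr-involutive M i v) (nbr-involutive N i w)

  -- two vertices joined by k parallel edges; dipole ⊗ M is the bipartite double cover of M
  dipole : Matchings k Bool
  dipole = record { nbr = λ _ → not ; nbr-involutive = λ _ → not-involutive }

  dipole-loopless : Loopless dipole
  dipole-loopless _ true  ()
  dipole-loopless _ false ()

  dipole-cover : MatchingCover dipole k id
  dipole-cover = record
    { independent = λ { _ true _ → refl }
    ; exact       = λ { false _ → countFin-true k }
    }

  transport : ∀ {A V} → A ↔ V → Matchings k V → Matchings k A
  transport e M = record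
    { nbr            = λ i → from ∘ nbr M i ∘ to
    ; nbr-involutive = λ i x → begin
        from (nbr M i (to (from (nbr M i (to x)))))  ≡⟨ cong (from ∘ nbr M i) (strictlyInverseˡ _) ⟩
        from (nbr M i (nbr M i (to x)))              ≡⟨ cong from (nbr-involutive M i (to x)) ⟩
        from (to x)                                  ≡⟨ strictlyInverseʳ x ⟩
        x                                            ∎
    }
    where open Inverse e

  transport-hom : ∀ {A V} (e : A ↔ V) (M : Matchings k V) → IsHomomorphism (transport e M) M (Inverse.to e)
  transport-hom e M = homomorphism (λ i x → Inverse.strictlyInverseˡ e _)

module MatchingGraph {k n} (M : Matchings k (Fin n)) (loopless : Loopless M) where

  adjacent? : ∀ u v → Dec (∃ λ i → v ≡ nbr M i u)
  adjacent? u v = any? (λ i → v ≟ᶠ nbr M i u)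

  adjacent-sym : ∀ {u v} → (∃ λ i → v ≡ nbr M i u) → ∃ λ i → u ≡ nbr M i v
  adjacent-sym {u} (i , refl) = i , sym (nbr-involutive M i u)

  graph : SimpleGraph n
  graph = record
    { adj    = λ u v → does (adjacent? u v)
    ; sym    = λ u v → does-⇔ (mk⇔ adjacent-sym adjacent-sym) (adjacent? u v) (adjacent? v u)
    ; irrefl = λ v → dec-false (adjacent? v v) (λ (i , e) → loopless i v (sym e))
    }

  adjacent : ∀ {u v} → adj graph u v ≡ true → ∃ λ i → v ≡ nbr M i u
  adjacent {u} {v} with adjacent? u v
  ... | yes uv = λ _ → uv
  ... | no  _  = λ ()

  module _ (no-multi-edges : NoMultiEdges M) where

    count-neighbours : ∀ v S → countFin (λ u → adj graph v u ∧ S u) ≡ countFin (λ i → S (nbr M i v))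
    count-neighbours v = countFin-image (λ i → nbr M i v) (no-multi-edges v)

    graph-regular : Regular k graph
    graph-regular v = begin
      countFin (adj graph v)                     ≡⟨ countFin-cong (λ u → ∧-identityʳ (adj graph v u)) ⟨
      countFin (λ u → adj graph v u ∧ true)      ≡⟨ count-neighbours v (λ _ → true) ⟩
      countFin {k} (λ _ → true)                  ≡⟨ countFin-true k ⟩
      k                                          ∎

    cover⇒independentExactCover : ∀ {r S} → MatchingCover M r S → IndependentExactCover graph r S
    cover⇒independentExactCover {r} {S} cover = independent , exact
      where
      independent : Independent graph S
      independent u v uv Su with adjacent uv
      ... | i , refl = MatchingCover.independent cover i u Su
      exact : ExactCover graph r S
      exact v Sv = trans (count-neighbours v S) (MatchingCover.exact cover v Sv)

-- The construction

all⊎? : ∀ {A B : Set} {P : A ⊎ B → Set} → Dec (∀ a → P (inj₁ a)) → Dec (∀ b → P (inj₂ b)) → Dec (∀ v → P v)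
all⊎? {P = P} left? right? = map′ (λ (l , r) → [_,_] {C = P} l r) (λ all → all ∘ inj₁ , all ∘ inj₂) (left? ×-dec right?)

module Gadget (r : ℕ) where

  Vertex : Set
  Vertex = Fin r ⊎ Fin 5

  shift : Fin 5 → Fin r → Fin 5
  shift i j = (toℕ j + toℕ i) mod 5

  swap : Fin 5 → Vertex → Vertex
  swap i (inj₁ j) = inj₂ (shift i j)
  swap i (inj₂ a) with any? (λ j → shift i j ≟ᶠ a)
  ... | yes (j , _) = inj₁ j
  ... | no  _       = inj₂ a

  inCover : Vertex → Bool
  inCover v = is-just (isInj₁ v)

  _≟ᵛ_ : DecidableEquality Vertex
  _≟ᵛ_ = ≡-dec _≟ᶠ_ _≟ᶠ_

  swap-involutive? : Dec (∀ i v → swap i (swap i v) ≡ v)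
  swap-involutive? = all? λ i → all⊎? (all? λ j → swap i (swap i (inj₁ j)) ≟ᵛ inj₁ j)
                                      (all? λ a → swap i (swap i (inj₂ a)) ≟ᵛ inj₂ a)

  exact? : Dec (∀ a → countFin (λ i → inCover (swap i (inj₂ a))) ≡ r)
  exact? = all? λ a → countFin (λ i → inCover (swap i (inj₂ a))) ≟ r

  no-multi-edges? : Dec (∀ v i j → swap i v ≡ swap j v → i ≡ j)
  no-multi-edges? = all⊎? (all? λ a → distinct? (inj₁ a)) (all? λ b → distinct? (inj₂ b))
    where
    distinct? : ∀ v → Dec (∀ i j → swap i v ≡ swap j v → i ≡ j)
    distinct? v = all? λ i → all? λ j → (swap i v ≟ᵛ swap j v) →-dec (i ≟ᶠ j)

  gadget : {True swap-involutive?} → Matchings 5 Vertex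
  gadget {involutive} = record { nbr = swap ; nbr-involutive = toWitness involutive }

  gadget-cover : ∀ {involutive} → {True exact?} → MatchingCover (gadget {involutive}) r inCover
  gadget-cover {_} {counts} = record
    { independent = λ { i (inj₁ j) _ → refl ; i (inj₂ a) () }
    ; exact       = λ { (inj₂ a) _ → toWitness counts a }
    }

  gadget-no-multi-edges : ∀ {involutive} → {True no-multi-edges?} → NoMultiEdges (gadget {involutive})
  gadget-no-multi-edges {_} {distinct} v = toWitness distinct v _ _

module Construction where

  open Gadget using (gadget; gadget-cover)
  open MatchingGraph using (graph; graph-regular; cover⇒independentExactCover)

  Vertex : Set
  Vertex = Bool × (Gadget.Vertex 1 × (Gadget.Vertex 2 × (Gadget.Vertex 3 × Gadget.Vertex 4)))

  product : Matchings 5 Vertex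
  product = dipole ⊗ gadget 1 ⊗ gadget 2 ⊗ gadget 3 ⊗ gadget 4

  Fin6048↔Vertex : Fin 6048 ↔ Vertex
  Fin6048↔Vertex = 2↔Bool ⊠ +↔⊎ ⊠ +↔⊎ ⊠ +↔⊎ ⊠ +↔⊎
    where
    infixr 5 _⊠_
    _⊠_ : ∀ {m n} {A B : Set} → Fin m ↔ A → Fin n ↔ B → Fin (m * n) ↔ (A × B)
    e ⊠ f = (e ×-↔ f) ↔-∘ *↔×

  side : IsHomomorphism product dipole proj₁
  side = homomorphism (λ _ _ → refl)

  layer₁ : IsHomomorphism product (gadget 1) (proj₁ ∘ proj₂)
  layer₁ = homomorphism (λ _ _ → refl)

  layer₂ : IsHomomorphism product (gadget 2) (proj₁ ∘ proj₂ ∘ proj₂)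
  layer₂ = homomorphism (λ _ _ → refl)

  layer₃ : IsHomomorphism product (gadget 3) (proj₁ ∘ proj₂ ∘ proj₂ ∘ proj₂)
  layer₃ = homomorphism (λ _ _ → refl)

  layer₄ : IsHomomorphism product (gadget 4) (proj₂ ∘ proj₂ ∘ proj₂ ∘ proj₂)
  layer₄ = homomorphism (λ _ _ → refl)

  matchings : Matchings 5 (Fin 6048)
  matchings = transport Fin6048↔Vertex product

  to-hom : IsHomomorphism matchings product (Inverse.to Fin6048↔Vertex)
  to-hom = transport-hom Fin6048↔Vertex product

  loopless : Loopless matchings
  loopless = Loopless-pullback to-hom (Loopless-pullback side dipole-loopless)

  no-multi-edges : NoMultiEdges matchings
  no-multi-edges = NoMultiEdges-pullback to-hom (NoMultiEdges-pullback layer₄ (Gadget.gadget-no-multi-edges 4))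

  regular : Regular 5 (graph matchings loopless)
  regular = graph-regular matchings loopless no-multi-edges

  cover-from : ∀ {W} {N : Matchings 5 W} {π : Vertex → W} → IsHomomorphism product N π →
               ∀ {r S} → MatchingCover N r S → MatchingCover matchings r ((S ∘ π) ∘ Inverse.to Fin6048↔Vertex)
  cover-from π-hom cover = MatchingCover-pullback to-hom (MatchingCover-pullback π-hom cover)

  graph-cover : ∀ {r S} → MatchingCover matchings r S → IndependentExactCover (graph matchings loopless) r S
  graph-cover = cover⇒independentExactCover matchings loopless no-multi-edges

  covers : HasAllCovers (graph matchings loopless)
  covers 0 () _
  covers 1 _ _ = _ , graph-cover (cover-from layer₁ (gadget-cover 1))
  covers 2 _ _ = _ , graph-cover (cover-from layer₂ (gadget-cover 2))
  covers 3 _ _ = _ , graph-cover (cover-from layer₃ (gadget-cover 3))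
  covers 4 _ _ = _ , graph-cover (cover-from layer₄ (gadget-cover 4))
  covers 5 _ _ = _ , graph-cover (cover-from side dipole-cover)
  covers (suc (suc (suc (suc (suc (suc _)))))) _ (s≤s (s≤s (s≤s (s≤s (s≤s ())))))

proposition4p7 : Σ (SimpleGraph 6048) (λ G → Regular 5 G × HasAllCovers G)
                 × (∀ (n : ℕ) → 1 ≤ n → (G : SimpleGraph n) → Regular 5 G → HasAllCovers G → 6048 ≤ n)
proposition4p7 = (graph matchings loopless , regular , covers) , lower-bound
  where open Construction
        open MatchingGraph using (graph)
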